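{- Let $k\ge 1$ and $\alpha\ge 1$ be integers and let $G$ be a $K_k$-free graph with $\alpha(G)<\alpha$. Then for every integer $1\le i\le k$, $$t_i(G)\le \frac{1}{i!}\,\alpha^{\binom{k}{2}-\binom{k-i}{2}}.$$
   Context: $t_i(G)$ denotes the number of copies of $K_i$ in $G$ (with $t_1(G)$ the number of vertices); $\alpha(G)$ is the independence number. -}

module Defs where

open import Data.Nat using (ℕ; zero; suc; _≟_; _<_)
open import Data.Fin using (Fin)
import Data.Fin.Properties as FinP
open import Data.Fin.Subset using (Subset; _∈_; ∣_∣; inside; outside)
open import Data.Fin.Subset.Properties using (_∈?_)
open import Data.Vec using (_∷_; [])
open import Data.List using (List; [_]; map; _++_; filter; length)
open import Data.Product using (_×_)
open import Relation.Nullary using (¬_; Dec)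
open import Relation.Nullary.Decidable using (_→-dec_; _×-dec_; ¬?)
open import Relation.Binary using (Decidable; Symmetric; Irreflexive)
open import Relation.Binary.PropositionalEquality using (_≡_)

record Graph (n : ℕ) : Set₁ where
  field
    Adj    : Fin n → Fin n → Set
    adj?   : Decidable Adj
    sym    : Symmetric Adj
    irrefl : Irreflexive _≡_ Adj
open Graph public

IsClique : ∀ {n} → Graph n → Subset n → Set
IsClique G S = ∀ x y → x ∈ S → y ∈ S → ¬ (x ≡ y) → Adj G x y

IsIndependent : ∀ {n} → Graph n → Subset n → Set
IsIndependent G S = ∀ x y → x ∈ S → y ∈ S → ¬ Adj G x y

isClique? : ∀ {n} (G : Graph n) (S : Subset n) → Dec (IsClique G S)
isClique? G S =
  FinP.all? λ x → FinP.all? λ y →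
    (x ∈? S) →-dec ((y ∈? S) →-dec (¬? (x FinP.≟ y) →-dec adj? G x y))

allSubsets : ∀ n → List (Subset n)
allSubsets zero    = [ [] ]
allSubsets (suc n) = map (outside ∷_) (allSubsets n) ++ map (inside ∷_) (allSubsets n)

IsKClique : ∀ {n} → Graph n → ℕ → Subset n → Set
IsKClique G i S = IsClique G S × (∣ S ∣ ≡ i)

t : ∀ {n} → ℕ → Graph n → ℕ
t i G = length (filter (λ S → isClique? G S ×-dec (∣ S ∣ ≟ i)) (allSubsets _))

KFree : ∀ {n} → ℕ → Graph n → Set
KFree k G = ∀ S → IsClique G S → ¬ (∣ S ∣ ≡ k)

IndepLess : ∀ {n} → Graph n → ℕ → Set
IndepLess G a = ∀ S → IsIndependent G S → ∣ S ∣ < a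

module Submission where

-- The bound is proved for the cliques inside an arbitrary vertex set W, by
-- induction on i.  Counting the pairs (v, X) with X an (i+1)-clique of W and
-- v ∈ X gives  (i+1) · #(i+1)-cliques(W) = Σ_{v ∈ W} #i-cliques(N_W(v)),  where
-- N_W(v) is the neighbourhood of v in W.  If W is K_{k+1}-free then N_W(v) is
-- K_k-free, so by induction each summand is at most a^(C(k,2) − C(k−i,2)) / i!,
-- while the Ramsey-type bound |W| < a^k (proved by splitting W at a vertex
-- into neighbours and non-neighbours) bounds the number of summands.  Since
-- k + C(k,2) = C(k+1,2), the exponents add up.

open import Defs hiding (sym)
open import Data.Nat using (ℕ; zero; suc; _+_; _*_; _^_; _∸_; _!; _≤_; _<_; z≤n; s≤s; _≟_; _≤′_; ≤′-refl; ≤′-step)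
open import Data.Nat.Properties
open import Data.Nat.Combinatorics using (_C_; nCk+nC[k+1]≡[n+1]C[k+1]; nC1≡n)
open import Data.Bool using (true; false; if_then_else_)
open import Data.Fin using (Fin; zero; suc)
import Data.Fin.Properties as FinP
open import Data.Fin.Subset using (Subset; _∈_; _∉_; _⊆_; ∣_∣; inside; outside; ⁅_⁆; ⊤)
open import Data.Fin.Subset.Properties
  using (_∈?_; _⊆?_; x∈⁅x⁆; x∈⁅y⁆⇒x≡y; ∣⁅x⁆∣≡1; nonempty?; Empty-unique; ∣⊥∣≡0; ⊆⊤)
open import Data.Vec using ([]; _∷_; here; there; tabulate; _[_]≔_)
open import Data.Vec.Properties using ([]≔-updates; []≔-minimal)
open import Data.List using (List; length; filter; map; _++_)
import Data.List.Properties as ListP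
open import Data.Product using (_×_; _,_; proj₁; proj₂)
open import Data.Sum using (_⊎_; inj₁; inj₂)
open import Data.Empty using (⊥-elim)
open import Relation.Nullary using (¬_; Dec; yes; no; does)
open import Relation.Nullary.Decidable using (_×-dec_; ¬?)
open import Relation.Binary.PropositionalEquality
  using (_≡_; refl; sym; trans; cong; cong₂; subst; module ≡-Reasoning)
open import Algebra.Properties.CommutativeSemigroup +-commutativeSemigroup using (interchange)
open import Algebra.Properties.Semiring.Sum +-*-semiring
  using (sum; sum-syntax; sum-cong-≗; ∑-distrib-+; *-distribˡ-sum)

-- Conditional values and indicators of decisions

infixl 6 _when_

_when_ : {A : Set} → ℕ → Dec A → ℕ
x when d = if does d then x else 0

𝟙 : {A : Set} → Dec A → ℕ
𝟙 d = 1 when d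

when-cong : {A B : Set} {x : ℕ} → (A → B) → (B → A) → (a : Dec A) (b : Dec B) →
  x when a ≡ x when b
when-cong f g (yes a) (yes b) = refl
when-cong f g (yes a) (no ¬b) = ⊥-elim (¬b (f a))
when-cong f g (no ¬a) (yes b) = ⊥-elim (¬a (g b))
when-cong f g (no ¬a) (no ¬b) = refl

when-× : {A B : Set} (x : ℕ) (a : Dec A) (b : Dec B) → x when b when a ≡ x when (a ×-dec b)
when-× x (yes _) b = refl
when-× x (no _) b = refl

when-*ˡ : {A : Set} (c x : ℕ) (d : Dec A) → c * (x when d) ≡ (c * x) when d
when-*ˡ c x (yes _) = refl
when-*ˡ c x (no _) = *-zeroʳ c

when-mono : {A : Set} {x y : ℕ} (d : Dec A) → (A → x ≤ y) → x when d ≤ y when d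
when-mono (yes a) x≤y = x≤y a
when-mono (no _) x≤y = z≤n

𝟙-mono : {A B : Set} (a : Dec A) (b : Dec B) → (A → B) → 𝟙 a ≤ 𝟙 b
𝟙-mono (yes _) (yes _) A⇒B = ≤-refl
𝟙-mono (yes a) (no ¬b) A⇒B = ⊥-elim (¬b (A⇒B a))
𝟙-mono (no _) b A⇒B = z≤n

𝟙-weight : {A : Set} (d : Dec A) {m c : ℕ} → (A → m ≡ c) → 𝟙 d * c ≡ m * 𝟙 d
𝟙-weight (yes a) {m} {c} m≡c = trans (*-identityˡ c) (trans (sym (m≡c a)) (sym (*-identityʳ m)))
𝟙-weight (no _) {m} _ = sym (*-zeroʳ m)

𝟙-split : {W E A : Set} (w : Dec W) (e : Dec E) (a : Dec A) → (E → W) → (E → ¬ A) →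
  𝟙 w ≡ 𝟙 e + (𝟙 (w ×-dec a) + 𝟙 (w ×-dec (¬? a ×-dec ¬? e)))
𝟙-split (no ¬w) (yes e) a e⇒w e⇒¬a = ⊥-elim (¬w (e⇒w e))
𝟙-split (no ¬w) (no _) a e⇒w e⇒¬a = refl
𝟙-split (yes _) (yes e) (yes a) e⇒w e⇒¬a = ⊥-elim (e⇒¬a e a)
𝟙-split (yes _) (yes _) (no _) e⇒w e⇒¬a = refl
𝟙-split (yes _) (no _) (yes _) e⇒w e⇒¬a = refl
𝟙-split (yes _) (no _) (no _) e⇒w e⇒¬a = refl

-- Finite sums

sum-mono : ∀ {m} {f g : Fin m → ℕ} → (∀ x → f x ≤ g x) → sum f ≤ sum g
sum-mono {zero} f≤g = z≤n
sum-mono {suc m} f≤g = +-mono-≤ (f≤g zero) (sum-mono (λ x → f≤g (suc x)))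

Σₛ : ∀ m → (Subset m → ℕ) → ℕ
Σₛ zero f = f []
Σₛ (suc m) f = Σₛ m (λ X → f (outside ∷ X)) + Σₛ m (λ X → f (inside ∷ X))

Σₛ-cong : ∀ m {f g : Subset m → ℕ} → (∀ X → f X ≡ g X) → Σₛ m f ≡ Σₛ m g
Σₛ-cong zero f≡g = f≡g []
Σₛ-cong (suc m) f≡g = cong₂ _+_ (Σₛ-cong m (λ X → f≡g (outside ∷ X))) (Σₛ-cong m (λ X → f≡g (inside ∷ X)))

Σₛ-mono : ∀ m {f g : Subset m → ℕ} → (∀ X → f X ≤ g X) → Σₛ m f ≤ Σₛ m g
Σₛ-mono zero f≤g = f≤g []
Σₛ-mono (suc m) f≤g = +-mono-≤ (Σₛ-mono m (λ X → f≤g (outside ∷ X))) (Σₛ-mono m (λ X → f≤g (inside ∷ X)))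

Σₛ-zero : ∀ m → Σₛ m (λ _ → 0) ≡ 0
Σₛ-zero zero = refl
Σₛ-zero (suc m) = cong₂ _+_ (Σₛ-zero m) (Σₛ-zero m)

Σₛ-+ : ∀ m (f g : Subset m → ℕ) → Σₛ m (λ X → f X + g X) ≡ Σₛ m f + Σₛ m g
Σₛ-+ zero f g = refl
Σₛ-+ (suc m) f g = trans
  (cong₂ _+_ (Σₛ-+ m (λ X → f (outside ∷ X)) (λ X → g (outside ∷ X)))
             (Σₛ-+ m (λ X → f (inside ∷ X)) (λ X → g (inside ∷ X))))
  (interchange (Σₛ m (λ X → f (outside ∷ X))) (Σₛ m (λ X → g (outside ∷ X)))
               (Σₛ m (λ X → f (inside ∷ X))) (Σₛ m (λ X → g (inside ∷ X))))

Σₛ-*ʳ : ∀ m (f : Subset m → ℕ) c → Σₛ m f * c ≡ Σₛ m (λ X → f X * c)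
Σₛ-*ʳ zero f c = refl
Σₛ-*ʳ (suc m) f c = trans (*-distribʳ-+ c (Σₛ m _) (Σₛ m _)) (cong₂ _+_ (Σₛ-*ʳ m _ c) (Σₛ-*ʳ m _ c))

Σₛ-when : ∀ m {A : Set} (f : Subset m → ℕ) (d : Dec A) → Σₛ m (λ X → f X when d) ≡ Σₛ m f when d
Σₛ-when m f (yes _) = refl
Σₛ-when m f (no _) = Σₛ-zero m

Σₛ-∑ : ∀ m r (F : Fin r → Subset m → ℕ) → Σₛ m (λ X → ∑[ v < r ] F v X) ≡ ∑[ v < r ] Σₛ m (F v)
Σₛ-∑ m zero F = Σₛ-zero m
Σₛ-∑ m (suc r) F = trans (Σₛ-+ m (F zero) _) (cong (Σₛ m (F zero) +_) (Σₛ-∑ m r (λ v → F (suc v))))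

Σₛ-empty : ∀ m → Σₛ m (λ X → 𝟙 (∣ X ∣ ≟ 0)) ≡ 1
Σₛ-empty zero = refl
Σₛ-empty (suc m) = cong₂ _+_ (Σₛ-empty m) (Σₛ-zero m)

count-filter-map : {A B : Set} {P : B → Set} (P? : ∀ y → Dec (P y)) (f : A → B) (xs : List A) →
  length (filter P? (map f xs)) ≡ length (filter (λ x → P? (f x)) xs)
count-filter-map P? f List.[] = refl
count-filter-map P? f (x List.∷ xs) with does (P? (f x))
... | true = cong suc (count-filter-map P? f xs)
... | false = count-filter-map P? f xs

count-subsets : ∀ m {P : Subset m → Set} (P? : ∀ X → Dec (P X)) →
  length (filter P? (allSubsets m)) ≡ Σₛ m (λ X → 𝟙 (P? X))
count-subsets zero P? with P? []
... | yes _ = refl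
... | no _ = refl
count-subsets (suc m) P? = begin
  length (filter P? (map (outside ∷_) (allSubsets m) ++ map (inside ∷_) (allSubsets m)))
    ≡⟨ cong length (ListP.filter-++ P? (map (outside ∷_) (allSubsets m)) _) ⟩
  length (filter P? (map (outside ∷_) (allSubsets m)) ++ filter P? (map (inside ∷_) (allSubsets m)))
    ≡⟨ ListP.length-++ (filter P? (map (outside ∷_) (allSubsets m))) ⟩
  length (filter P? (map (outside ∷_) (allSubsets m))) + length (filter P? (map (inside ∷_) (allSubsets m)))
    ≡⟨ cong₂ _+_ (trans (count-filter-map P? (outside ∷_) (allSubsets m)) (count-subsets m (λ X → P? (outside ∷ X))))
                 (trans (count-filter-map P? (inside ∷_) (allSubsets m)) (count-subsets m (λ X → P? (inside ∷ X)))) ⟩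
  Σₛ (suc m) (λ X → 𝟙 (P? X)) ∎
  where open ≡-Reasoning

card-sum : ∀ {m} (X : Subset m) (c : ℕ) → ∣ X ∣ * c ≡ ∑[ x < m ] (c when (x ∈? X))
card-sum [] c = refl
card-sum (inside ∷ X) c = cong (c +_) (card-sum X c)
card-sum (outside ∷ X) c = card-sum X c

card-count : ∀ {m} (X : Subset m) → ∣ X ∣ ≡ ∑[ x < m ] 𝟙 (x ∈? X)
card-count X = trans (sym (*-identityʳ ∣ X ∣)) (card-sum X 1)

card-partition : ∀ {m} (W P Q R : Subset m) →
  (∀ x → 𝟙 (x ∈? W) ≡ 𝟙 (x ∈? P) + (𝟙 (x ∈? Q) + 𝟙 (x ∈? R))) → ∣ W ∣ ≡ ∣ P ∣ + (∣ Q ∣ + ∣ R ∣)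
card-partition {m} W P Q R split = begin
  ∣ W ∣                                               ≡⟨ card-count W ⟩
  ∑[ x < m ] 𝟙 (x ∈? W)                               ≡⟨ sum-cong-≗ split ⟩
  ∑[ x < m ] (𝟙 (x ∈? P) + (𝟙 (x ∈? Q) + 𝟙 (x ∈? R)))  ≡⟨ ∑-distrib-+ (λ x → 𝟙 (x ∈? P)) _ ⟩
  ∑[ x < m ] 𝟙 (x ∈? P) + ∑[ x < m ] (𝟙 (x ∈? Q) + 𝟙 (x ∈? R))
    ≡⟨ cong (∑[ x < m ] 𝟙 (x ∈? P) +_) (∑-distrib-+ (λ x → 𝟙 (x ∈? Q)) _) ⟩
  ∑[ x < m ] 𝟙 (x ∈? P) + (∑[ x < m ] 𝟙 (x ∈? Q) + ∑[ x < m ] 𝟙 (x ∈? R))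
    ≡⟨ sym (cong₂ _+_ (card-count P) (cong₂ _+_ (card-count Q) (card-count R))) ⟩
  ∣ P ∣ + (∣ Q ∣ + ∣ R ∣) ∎
  where open ≡-Reasoning

insert : ∀ {m} → Fin m → Subset m → Subset m
insert v Y = Y [ v ]≔ inside

∈-insert : ∀ {m} (v : Fin m) (Y : Subset m) → v ∈ insert v Y
∈-insert v Y = []≔-updates Y v

∈-insert⁺ : ∀ {m} (v : Fin m) (Y : Subset m) {x} → x ∈ Y → x ∈ insert v Y
∈-insert⁺ v Y {x} x∈Y with x FinP.≟ v
... | yes refl = ∈-insert v Y
... | no x≢v = []≔-minimal Y x v x≢v x∈Y

∈-insert⁻ : ∀ {m} (v : Fin m) (Y : Subset m) {x} → x ∈ insert v Y → x ≡ v ⊎ x ∈ Y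
∈-insert⁻ zero (s ∷ Y) here = inj₁ refl
∈-insert⁻ zero (s ∷ Y) (there x∈Y) = inj₂ (there x∈Y)
∈-insert⁻ (suc v) (s ∷ Y) here = inj₂ here
∈-insert⁻ (suc v) (s ∷ Y) (there x∈vY) with ∈-insert⁻ v Y x∈vY
... | inj₁ x≡v = inj₁ (cong suc x≡v)
... | inj₂ x∈Y = inj₂ (there x∈Y)

insert-card : ∀ {m} (v : Fin m) (Y : Subset m) → v ∉ Y → ∣ insert v Y ∣ ≡ suc ∣ Y ∣
insert-card zero (inside ∷ Y) v∉Y = ⊥-elim (v∉Y here)
insert-card zero (outside ∷ Y) v∉Y = refl
insert-card (suc v) (inside ∷ Y) v∉Y = cong suc (insert-card v Y (λ v∈Y → v∉Y (there v∈Y)))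
insert-card (suc v) (outside ∷ Y) v∉Y = insert-card v Y (λ v∈Y → v∉Y (there v∈Y))

insert-⊆ : ∀ {m} {v : Fin m} {Y W : Subset m} → v ∈ W → Y ⊆ W → insert v Y ⊆ W
insert-⊆ {v = v} {Y} v∈W Y⊆W x∈vY with ∈-insert⁻ v Y x∈vY
... | inj₁ refl = v∈W
... | inj₂ x∈Y = Y⊆W x∈Y

Σₛ-insert : ∀ m (u : Fin m) (F : Subset m → ℕ) →
  Σₛ m (λ X → F X when (u ∈? X)) ≡ Σₛ m (λ Y → F (insert u Y) when ¬? (u ∈? Y))
Σₛ-insert (suc m) zero F = begin
  Σₛ m (λ _ → 0) + Σₛ m G  ≡⟨ cong (_+ Σₛ m G) (Σₛ-zero m) ⟩
  Σₛ m G                   ≡⟨ +-identityʳ (Σₛ m G) ⟨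
  Σₛ m G + 0               ≡⟨ cong (Σₛ m G +_) (Σₛ-zero m) ⟨
  Σₛ m G + Σₛ m (λ _ → 0)  ∎
  where
  open ≡-Reasoning
  G : Subset m → ℕ
  G X = F (inside ∷ X)
Σₛ-insert (suc m) (suc u) F =
  cong₂ _+_ (Σₛ-insert m u (λ X → F (outside ∷ X))) (Σₛ-insert m u (λ X → F (inside ∷ X)))

select : ∀ {m} {P : Fin m → Set} → (∀ x → Dec (P x)) → Subset m
select P? = tabulate (λ x → does (P? x))

select⁻ : ∀ {m} {P : Fin m → Set} (P? : ∀ x → Dec (P x)) {x} → x ∈ select P? → P x
select⁻ P? {zero} x∈P with P? zero
... | yes Px = Px
select⁻ P? {zero} () | no _
select⁻ P? {suc x} (there x∈P) = select⁻ (λ y → P? (suc y)) x∈P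

select⁺ : ∀ {m} {P : Fin m → Set} (P? : ∀ x → Dec (P x)) {x} → P x → x ∈ select P?
select⁺ P? {zero} Px with P? zero
... | yes _ = here
... | no ¬Px = ⊥-elim (¬Px Px)
select⁺ P? {suc x} Px = there (select⁺ (λ y → P? (suc y)) Px)

𝟙-select : ∀ {m} {P : Fin m → Set} (P? : ∀ x → Dec (P x)) x → 𝟙 (x ∈? select P?) ≡ 𝟙 (P? x)
𝟙-select P? x = when-cong (select⁻ P?) (select⁺ P?) (x ∈? select P?) (P? x)

⁅⁆-≡ : ∀ {m} (v : Fin m) {x y} → x ∈ ⁅ v ⁆ → y ∈ ⁅ v ⁆ → x ≡ y
⁅⁆-≡ v x∈v y∈v = trans (x∈⁅y⁆⇒x≡y v x∈v) (sym (x∈⁅y⁆⇒x≡y v y∈v))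

⁅⁆-⊆ : ∀ {m} {v : Fin m} {W : Subset m} → v ∈ W → ⁅ v ⁆ ⊆ W
⁅⁆-⊆ {v = v} v∈W x∈v = subst (_∈ _) (sym (x∈⁅y⁆⇒x≡y v x∈v)) v∈W

-- Arithmetic of the bounds

-- The arithmetic of the Ramsey recursion |W| = 1 + |N| + |M|:
-- (a + 2)^k + (a + 1)^(k+1) ≤ (a + 2)^(k+1).
ramsey-step : ∀ a k {x y} → x < suc (suc a) ^ k → y < suc a ^ suc k → suc (x + y) < suc (suc a) ^ suc k
ramsey-step a k {x} {y} x< y< = subst (_≤ suc (suc a) ^ suc k) (+-suc (suc x) y)
  (+-mono-≤ x< (≤-trans y< (*-monoʳ-≤ (suc a) (^-monoˡ-≤ k (n≤1+n (suc a))))))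

C2-suc : ∀ n → suc n C 2 ≡ n + n C 2
C2-suc n = trans (sym (nCk+nC[k+1]≡[n+1]C[k+1] n 1)) (cong (_+ n C 2) (nC1≡n n))

C2-mono : ∀ {m n} → m ≤ n → m C 2 ≤ n C 2
C2-mono m≤n = mono (≤⇒≤′ m≤n)
  where
  mono : ∀ {m n} → m ≤′ n → m C 2 ≤ n C 2
  mono ≤′-refl = ≤-refl
  mono {n = suc n} (≤′-step m≤′n) = ≤-trans (mono m≤′n) (≤-trans (m≤n+m (n C 2) n) (≤-reflexive (sym (C2-suc n))))

exponent-step : ∀ k m → m ≤ k C 2 → k + (k C 2 ∸ m) ≡ suc k C 2 ∸ m
exponent-step k m m≤kC2 = trans (sym (+-∸-assoc k m≤kC2)) (cong (_∸ m) (sym (C2-suc k)))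

module _ {n : ℕ} (G : Graph n) where

  KFreeIn : ℕ → Subset n → Set
  KFreeIn k W = ∀ X → X ⊆ W → IsClique G X → ¬ (∣ X ∣ ≡ k)

  IndepLessIn : ℕ → Subset n → Set
  IndepLessIn a W = ∀ X → X ⊆ W → IsIndependent G X → ∣ X ∣ < a

  clique-⊆ : ∀ {X Y} → X ⊆ Y → IsClique G Y → IsClique G X
  clique-⊆ X⊆Y clique x y x∈X y∈X = clique x y (X⊆Y x∈X) (X⊆Y y∈X)

  KFreeIn-⊆ : ∀ {k V W} → V ⊆ W → KFreeIn k W → KFreeIn k V
  KFreeIn-⊆ V⊆W kfree X X⊆V = kfree X (λ x∈X → V⊆W (X⊆V x∈X))

  IndepLessIn-⊆ : ∀ {a V W} → V ⊆ W → IndepLessIn a W → IndepLessIn a V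
  IndepLessIn-⊆ V⊆W indep X X⊆V = indep X (λ x∈X → V⊆W (X⊆V x∈X))

  neighbour? : (W : Subset n) (v x : Fin n) → Dec (x ∈ W × Adj G v x)
  neighbour? W v x = (x ∈? W) ×-dec adj? G v x

  nonNeighbour? : (W : Subset n) (v x : Fin n) → Dec (x ∈ W × ¬ Adj G v x × ¬ x ≡ v)
  nonNeighbour? W v x = (x ∈? W) ×-dec (¬? (adj? G v x) ×-dec ¬? (x FinP.≟ v))

  N : Subset n → Fin n → Subset n
  N W v = select (neighbour? W v)

  M : Subset n → Fin n → Subset n
  M W v = select (nonNeighbour? W v)

  N⁻ : ∀ W v {x} → x ∈ N W v → x ∈ W × Adj G v x
  N⁻ W v = select⁻ (neighbour? W v)

  M⁻ : ∀ W v {x} → x ∈ M W v → x ∈ W × ¬ Adj G v x × ¬ x ≡ v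
  M⁻ W v = select⁻ (nonNeighbour? W v)

  N⊆ : ∀ W v → N W v ⊆ W
  N⊆ W v x∈N = proj₁ (N⁻ W v x∈N)

  M⊆ : ∀ W v → M W v ⊆ W
  M⊆ W v x∈M = proj₁ (M⁻ W v x∈M)

  card-split : ∀ W v → v ∈ W → ∣ W ∣ ≡ suc (∣ N W v ∣ + ∣ M W v ∣)
  card-split W v v∈W =
    trans (card-partition W ⁅ v ⁆ (N W v) (M W v) split) (cong (_+ (∣ N W v ∣ + ∣ M W v ∣)) (∣⁅x⁆∣≡1 v))
    where
    split : ∀ x → 𝟙 (x ∈? W) ≡ 𝟙 (x ∈? ⁅ v ⁆) + (𝟙 (x ∈? N W v) + 𝟙 (x ∈? M W v))
    split x = begin
      𝟙 (x ∈? W)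
        ≡⟨ 𝟙-split (x ∈? W) (x FinP.≟ v) (adj? G v x) (λ { refl → v∈W }) (λ { refl → irrefl G refl }) ⟩
      𝟙 (x FinP.≟ v) + (𝟙 (neighbour? W v x) + 𝟙 (nonNeighbour? W v x))
        ≡⟨ sym (cong₂ _+_ (when-cong (x∈⁅y⁆⇒x≡y v) (λ { refl → x∈⁅x⁆ v }) (x ∈? ⁅ v ⁆) (x FinP.≟ v))
                          (cong₂ _+_ (𝟙-select (neighbour? W v) x) (𝟙-select (nonNeighbour? W v) x))) ⟩
      𝟙 (x ∈? ⁅ v ⁆) + (𝟙 (x ∈? N W v) + 𝟙 (x ∈? M W v)) ∎
      where open ≡-Reasoning

  extend-clique : ∀ W v Y → Y ⊆ N W v → IsClique G Y → IsClique G (insert v Y)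
  extend-clique W v Y Y⊆N clique x y x∈vY y∈vY x≢y with ∈-insert⁻ v Y x∈vY | ∈-insert⁻ v Y y∈vY
  ... | inj₁ refl | inj₁ refl = ⊥-elim (x≢y refl)
  ... | inj₁ refl | inj₂ y∈Y = proj₂ (N⁻ W v (Y⊆N y∈Y))
  ... | inj₂ x∈Y | inj₁ refl = Graph.sym G (proj₂ (N⁻ W v (Y⊆N x∈Y)))
  ... | inj₂ x∈Y | inj₂ y∈Y = clique x y x∈Y y∈Y x≢y

  extend-independent : ∀ W v Y → Y ⊆ M W v → IsIndependent G Y → IsIndependent G (insert v Y)
  extend-independent W v Y Y⊆M indep x y x∈vY y∈vY with ∈-insert⁻ v Y x∈vY | ∈-insert⁻ v Y y∈vY
  ... | inj₁ refl | inj₁ refl = irrefl G refl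
  ... | inj₁ refl | inj₂ y∈Y = proj₁ (proj₂ (M⁻ W v (Y⊆M y∈Y)))
  ... | inj₂ x∈Y | inj₁ refl = λ vx → proj₁ (proj₂ (M⁻ W v (Y⊆M x∈Y))) (Graph.sym G vx)
  ... | inj₂ x∈Y | inj₂ y∈Y = indep x y x∈Y y∈Y

  v∉N : ∀ W v → v ∉ N W v
  v∉N W v v∈N = irrefl G refl (proj₂ (N⁻ W v v∈N))

  v∉M : ∀ W v → v ∉ M W v
  v∉M W v v∈M = proj₂ (proj₂ (M⁻ W v v∈M)) refl

  KFreeIn-N : ∀ {k} W v → v ∈ W → KFreeIn (suc k) W → KFreeIn k (N W v)
  KFreeIn-N W v v∈W kfree Y Y⊆N clique |Y|≡k =
    kfree (insert v Y) (insert-⊆ v∈W (λ y∈Y → N⊆ W v (Y⊆N y∈Y))) (extend-clique W v Y Y⊆N clique)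
      (trans (insert-card v Y (λ v∈Y → v∉N W v (Y⊆N v∈Y))) (cong suc |Y|≡k))

  IndepLessIn-M : ∀ {a} W v → v ∈ W → IndepLessIn (suc a) W → IndepLessIn a (M W v)
  IndepLessIn-M W v v∈W indep Y Y⊆M independent = ≤-pred (subst (_< _)
    (insert-card v Y (λ v∈Y → v∉M W v (Y⊆M v∈Y)))
    (indep (insert v Y) (insert-⊆ v∈W (λ y∈Y → M⊆ W v (Y⊆M y∈Y))) (extend-independent W v Y Y⊆M independent)))

  singleton-clique : ∀ v → IsClique G ⁅ v ⁆
  singleton-clique v x y x∈v y∈v x≢y = ⊥-elim (x≢y (⁅⁆-≡ v x∈v y∈v))

  singleton-independent : ∀ v → IsIndependent G ⁅ v ⁆
  singleton-independent v x y x∈v y∈v = subst (λ z → ¬ Adj G x z) (⁅⁆-≡ v x∈v y∈v) (irrefl G refl)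

  -- Split W at a vertex v: its neighbours
  -- are K_k-free and its non-neighbours have independence number at most a - 1.
  ramsey : ∀ k a W → KFreeIn (suc k) W → IndepLessIn (suc a) W → ∣ W ∣ < suc a ^ k
  ramsey k a W kfree indep with nonempty? W
  ... | no empty = subst (_< suc a ^ k) (sym (trans (cong ∣_∣ (Empty-unique empty)) (∣⊥∣≡0 n))) (m^n>0 (suc a) k)
  ramsey zero a W kfree indep | yes (v , v∈W) =
    ⊥-elim (kfree ⁅ v ⁆ (⁅⁆-⊆ v∈W) (singleton-clique v) (∣⁅x⁆∣≡1 v))
  ramsey (suc k) zero W kfree indep | yes (v , v∈W) =
    ⊥-elim (<-irrefl (∣⁅x⁆∣≡1 v) (indep ⁅ v ⁆ (⁅⁆-⊆ v∈W) (singleton-independent v)))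
  ramsey (suc k) (suc a) W kfree indep | yes (v , v∈W) =
    subst (_< suc (suc a) ^ suc k) (sym (card-split W v v∈W)) (ramsey-step a k
      (ramsey k (suc a) (N W v) (KFreeIn-N W v v∈W kfree) (IndepLessIn-⊆ (N⊆ W v) indep))
      (ramsey (suc k) a (M W v) (KFreeIn-⊆ (M⊆ W v) kfree) (IndepLessIn-M W v v∈W indep)))

  kCliqueIn? : (i : ℕ) (W X : Subset n) → Dec (X ⊆ W × IsKClique G i X)
  kCliqueIn? i W X = (X ⊆? W) ×-dec (isClique? G X ×-dec (∣ X ∣ ≟ i))

  cliques : ℕ → Subset n → ℕ
  cliques i W = Σₛ n (λ X → 𝟙 (kCliqueIn? i W X))

  clique-extension : ∀ i W v Y →
    𝟙 (kCliqueIn? (suc i) W (insert v Y)) when ¬? (v ∈? Y) ≡ 𝟙 (kCliqueIn? i (N W v) Y) when (v ∈? W)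
  clique-extension i W v Y = begin
    𝟙 larger when ¬? (v ∈? Y)     ≡⟨ when-× 1 (¬? (v ∈? Y)) larger ⟩
    𝟙 (¬? (v ∈? Y) ×-dec larger)  ≡⟨ when-cong restrict extend (¬? (v ∈? Y) ×-dec larger) ((v ∈? W) ×-dec smaller) ⟩
    𝟙 ((v ∈? W) ×-dec smaller)    ≡⟨ when-× 1 (v ∈? W) smaller ⟨
    𝟙 smaller when (v ∈? W)       ∎
    where
    open ≡-Reasoning
    larger : Dec (insert v Y ⊆ W × IsKClique G (suc i) (insert v Y))
    larger = kCliqueIn? (suc i) W (insert v Y)
    smaller : Dec (Y ⊆ N W v × IsKClique G i Y)
    smaller = kCliqueIn? i (N W v) Y
    restrict : v ∉ Y × insert v Y ⊆ W × IsKClique G (suc i) (insert v Y) →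
               v ∈ W × Y ⊆ N W v × IsKClique G i Y
    restrict (v∉Y , vY⊆W , clique , size) =
      vY⊆W (∈-insert v Y) ,
      (λ {y} y∈Y → select⁺ (neighbour? W v) (vY⊆W (∈-insert⁺ v Y y∈Y) ,
        clique v y (∈-insert v Y) (∈-insert⁺ v Y y∈Y) (λ { refl → v∉Y y∈Y }))) ,
      clique-⊆ (∈-insert⁺ v Y) clique ,
      suc-injective (trans (sym (insert-card v Y v∉Y)) size)
    extend : v ∈ W × Y ⊆ N W v × IsKClique G i Y →
             v ∉ Y × insert v Y ⊆ W × IsKClique G (suc i) (insert v Y)
    extend (v∈W , Y⊆N , clique , size) =
      v∉Y , insert-⊆ v∈W (λ y∈Y → N⊆ W v (Y⊆N y∈Y)) , extend-clique W v Y Y⊆N clique ,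
      trans (insert-card v Y v∉Y) (cong suc size)
      where
      v∉Y : v ∉ Y
      v∉Y v∈Y = v∉N W v (Y⊆N v∈Y)

  -- Double counting the pairs (v, X) with X an (i+1)-clique of W and v ∈ X.
  double-count : ∀ i W → cliques (suc i) W * suc i ≡ ∑[ v < n ] (cliques i (N W v) when (v ∈? W))
  double-count i W = begin
    Σₛ n K * suc i                                         ≡⟨ Σₛ-*ʳ n K (suc i) ⟩
    Σₛ n (λ X → K X * suc i)
      ≡⟨ Σₛ-cong n (λ X → trans (𝟙-weight (kCliqueIn? (suc i) W X) (λ (_ , _ , size) → size)) (card-sum X (K X))) ⟩
    Σₛ n (λ X → ∑[ v < n ] (K X when (v ∈? X)))            ≡⟨ Σₛ-∑ n n (λ v X → K X when (v ∈? X)) ⟩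
    ∑[ v < n ] Σₛ n (λ X → K X when (v ∈? X))              ≡⟨ sum-cong-≗ (λ v → Σₛ-insert n v K) ⟩
    ∑[ v < n ] Σₛ n (λ Y → K (insert v Y) when ¬? (v ∈? Y))
      ≡⟨ sum-cong-≗ (λ v → Σₛ-cong n (clique-extension i W v)) ⟩
    ∑[ v < n ] Σₛ n (λ Y → 𝟙 (kCliqueIn? i (N W v) Y) when (v ∈? W))
      ≡⟨ sum-cong-≗ (λ v → Σₛ-when n (λ Y → 𝟙 (kCliqueIn? i (N W v) Y)) (v ∈? W)) ⟩
    ∑[ v < n ] (cliques i (N W v) when (v ∈? W))          ∎
    where
    open ≡-Reasoning
    K : Subset n → ℕ
    K X = 𝟙 (kCliqueIn? (suc i) W X)

  clique-bound : ∀ a i k W → i ≤ k → KFreeIn k W → IndepLessIn (suc a) W →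
    i ! * cliques i W ≤ suc a ^ (k C 2 ∸ (k ∸ i) C 2)
  clique-bound a zero k W _ _ _ = begin
    0 ! * cliques 0 W            ≡⟨ *-identityˡ (cliques 0 W) ⟩
    cliques 0 W                  ≤⟨ Σₛ-mono n (λ X → 𝟙-mono (kCliqueIn? 0 W X) (∣ X ∣ ≟ 0) (λ (_ , _ , size) → size)) ⟩
    Σₛ n (λ X → 𝟙 (∣ X ∣ ≟ 0))   ≡⟨ Σₛ-empty n ⟩
    1                            ≡⟨ cong (suc a ^_) (n∸n≡0 (k C 2)) ⟨
    suc a ^ (k C 2 ∸ k C 2)      ∎
    where open ≤-Reasoning
  clique-bound a (suc i) (suc k) W (s≤s i≤k) kfree indep = begin
    suc i ! * cliques (suc i) W                            ≡⟨ reorder ⟩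
    i ! * (cliques (suc i) W * suc i)                      ≡⟨ cong (i ! *_) (double-count i W) ⟩
    i ! * ∑[ v < n ] (cliques i (N W v) when (v ∈? W))     ≡⟨ *-distribˡ-sum (i !) (λ v → cliques i (N W v) when (v ∈? W)) ⟩
    ∑[ v < n ] (i ! * (cliques i (N W v) when (v ∈? W)))   ≡⟨ sum-cong-≗ (λ v → when-*ˡ (i !) _ (v ∈? W)) ⟩
    ∑[ v < n ] ((i ! * cliques i (N W v)) when (v ∈? W))   ≤⟨ sum-mono (λ v → when-mono (v ∈? W) (induction v)) ⟩
    ∑[ v < n ] (B when (v ∈? W))                           ≡⟨ card-sum W B ⟨
    ∣ W ∣ * B                                              ≤⟨ *-monoˡ-≤ B (<⇒≤ (ramsey k a W kfree indep)) ⟩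
    suc a ^ k * B                                          ≡⟨ ^-distribˡ-+-* (suc a) k _ ⟨
    suc a ^ (k + (k C 2 ∸ (k ∸ i) C 2))                    ≡⟨ cong (suc a ^_) (exponent-step k _ (C2-mono (m∸n≤m k i))) ⟩
    suc a ^ (suc k C 2 ∸ (k ∸ i) C 2)                      ∎
    where
    open ≤-Reasoning
    B : ℕ
    B = suc a ^ (k C 2 ∸ (k ∸ i) C 2)
    reorder : suc i ! * cliques (suc i) W ≡ i ! * (cliques (suc i) W * suc i)
    reorder = trans (cong (_* cliques (suc i) W) (*-comm (suc i) (i !)))
                    (trans (*-assoc (i !) (suc i) _) (cong (i ! *_) (*-comm (suc i) _)))
    induction : ∀ v → v ∈ W → i ! * cliques i (N W v) ≤ B
    induction v v∈W = clique-bound a i k (N W v) i≤k (KFreeIn-N W v v∈W kfree) (IndepLessIn-⊆ (N⊆ W v) indep)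

lemma2p3 : (k a n : ℕ) → 1 ≤ k → 1 ≤ a → (G : Graph n) → KFree k G → IndepLess G a →
    (i : ℕ) → 1 ≤ i → i ≤ k →
    (i !) * t i G ≤ a ^ ((k C 2) ∸ ((k ∸ i) C 2))
lemma2p3 k zero n _ () G kfree indep i _ i≤k
lemma2p3 k (suc a) n _ _ G kfree indep i _ i≤k =
  subst (λ c → i ! * c ≤ suc a ^ (k C 2 ∸ (k ∸ i) C 2)) (sym t≡cliques)
    (clique-bound G a i k ⊤ i≤k (λ X _ → kfree X) (λ X _ → indep X))
  where
  t≡cliques : t i G ≡ cliques G i ⊤
  t≡cliques = trans (count-subsets n (λ X → isClique? G X ×-dec (∣ X ∣ ≟ i)))
    (Σₛ-cong n (λ X → when-cong (λ X-clique → (λ {_} → ⊆⊤) , X-clique) proj₂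
                                (isClique? G X ×-dec (∣ X ∣ ≟ i)) (kCliqueIn? G i ⊤ X)))
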